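{- Every nonzero Turing degree contains a set $A$ with $\alpha(A) = 0$ and $\gamma(A) = 1/2$.
   Context: For $A \subseteq \omega$ and $n \ge 1$ let $\rho_n(A) = |A \cap \{0,\dots,n-1\}|/n$, $\underline{\rho}(A) = \liminf_n \rho_n(A)$. $A$ is partially computable at density $r$ if there is a partial computable function $\varphi$ with $\varphi(n) = A(n)$ for all $n \in \operatorname{dom}\varphi$ and $\underline{\rho}(\operatorname{dom}\varphi) \ge r$; the partial computability bound is $\alpha(A) = \sup\{r : A \text{ partially computable at density } r\}$. $A$ is coarsely computable at density $r$ if there is a computable set $C$ with $\underline{\rho}(\{n : A(n) = C(n)\}) \ge r$; the coarse computability bound is $\gamma(A) = \sup\{r : A \text{ coarsely computable at density } r\}$. -}

module Defs where

open import Data.Nat using (ℕ; zero; suc; _<_; _≤_)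
open import Data.Fin using (Fin)
open import Data.Vec using (Vec; []; _∷_; lookup)
open import Data.Bool using (Bool; true; false)
open import Data.List using (List; length)
open import Data.List.Relation.Unary.All using (All)
open import Data.List.Relation.Unary.Unique.Propositional using (Unique)
open import Data.Product using (Σ; _×_; ∃)
open import Data.Integer using (+_)
open import Data.Rational using (ℚ; _/_; 0ℚ; ½) renaming (_<_ to _<ℚ_; _≤_ to _≤ℚ_; _*_ to _*ℚ_; _-_ to _-ℚ_)
open import Relation.Binary.PropositionalEquality using (_≡_)
open import Relation.Nullary using (¬_)

-- Sets of naturals are characteristic functions ℕ → Bool.

bit : Bool → ℕ
bit false = 0
bit true  = 1

-- Oracle μ-recursive functions (a standard model of relative computation).

data Code : ℕ → Set where
  zro  : ∀ {k} → Code k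
  sucC : Code 1
  proj : ∀ {k} → Fin k → Code k
  orc  : Code 1
  comp : ∀ {k m} → Code m → Vec (Code k) m → Code k
  prec : ∀ {k} → Code k → Code (suc (suc k)) → Code (suc k)
  mu   : ∀ {k} → Code (suc k) → Code k

mutual
  -- Eval O c xs v : program c with oracle O on input xs halts with output v
  data Eval (O : ℕ → Bool) : ∀ {k} → Code k → Vec ℕ k → ℕ → Set where
    e-zro  : ∀ {k} {xs : Vec ℕ k} → Eval O zro xs 0
    e-suc  : ∀ {x} → Eval O sucC (x ∷ []) (suc x)
    e-proj : ∀ {k} (i : Fin k) {xs : Vec ℕ k} → Eval O (proj i) xs (lookup xs i)
    e-orc  : ∀ {x} → Eval O orc (x ∷ []) (bit (O x))
    e-comp : ∀ {k m} {f : Code m} {gs : Vec (Code k) m} {xs : Vec ℕ k} {ys : Vec ℕ m} {v : ℕ} →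
             EvalAll O gs xs ys → Eval O f ys v → Eval O (comp f gs) xs v
    e-prec0 : ∀ {k} {f : Code k} {g : Code (suc (suc k))} {xs : Vec ℕ k} {v : ℕ} →
              Eval O f xs v → Eval O (prec f g) (0 ∷ xs) v
    e-precS : ∀ {k} {f : Code k} {g : Code (suc (suc k))} {xs : Vec ℕ k} {y u v : ℕ} →
              Eval O (prec f g) (y ∷ xs) u → Eval O g (y ∷ u ∷ xs) v →
              Eval O (prec f g) (suc y ∷ xs) v
    e-mu   : ∀ {k} {f : Code (suc k)} {xs : Vec ℕ k} {y : ℕ} →
             Eval O f (y ∷ xs) 0 →
             (∀ z → z < y → Σ ℕ (λ w → Eval O f (z ∷ xs) (suc w))) →
             Eval O (mu f) xs y

  data EvalAll (O : ℕ → Bool) {k : ℕ} : ∀ {m} → Vec (Code k) m → Vec ℕ k → Vec ℕ m → Set where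
    ea-[] : ∀ {xs} → EvalAll O [] xs []
    ea-∷  : ∀ {m} {g : Code k} {gs : Vec (Code k) m} {xs : Vec ℕ k} {y : ℕ} {ys : Vec ℕ m} →
            Eval O g xs y → EvalAll O gs xs ys → EvalAll O (g ∷ gs) xs (y ∷ ys)

-- the empty oracle: unrelativised computation
∅ : ℕ → Bool
∅ _ = false

_≤T_ : (ℕ → Bool) → (ℕ → Bool) → Set
A ≤T B = Σ (Code 1) λ c → ∀ n → Eval B c (n ∷ []) (bit (A n))

_≡T_ : (ℕ → Bool) → (ℕ → Bool) → Set
A ≡T B = (A ≤T B) × (B ≤T A)

Computable : (ℕ → Bool) → Set
Computable A = A ≤T ∅

ℕtoℚ : ℕ → ℚ
ℕtoℚ n = + n / 1

-- ρ_n(D) ≥ q, i.e. |D ∩ {0..n-1}| ≥ q·n : witnessed by a duplicate-free list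
RhoAtLeast : (ℕ → Set) → ℕ → ℚ → Set
RhoAtLeast D n q = Σ (List ℕ) λ xs →
  Unique xs × All (λ x → (x < n) × D x) xs × (q *ℚ ℕtoℚ n ≤ℚ ℕtoℚ (length xs))

-- lower density: liminf_n ρ_n(D) ≥ r
LowerDensityAtLeast : (ℕ → Set) → ℚ → Set
LowerDensityAtLeast D r = ∀ (ε : ℚ) → 0ℚ <ℚ ε →
  Σ ℕ λ N → ∀ n → N ≤ n → RhoAtLeast D (suc n) (r -ℚ ε)

PartiallyComputableAt : (ℕ → Bool) → ℚ → Set
PartiallyComputableAt A r = Σ (Code 1) λ c →
  (∀ n v → Eval ∅ c (n ∷ []) v → v ≡ bit (A n)) ×
  LowerDensityAtLeast (λ n → Σ ℕ λ v → Eval ∅ c (n ∷ []) v) r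

CoarselyComputableAt : (ℕ → Bool) → ℚ → Set
CoarselyComputableAt A r = Σ (ℕ → Bool) λ C →
  Computable C × LowerDensityAtLeast (λ n → A n ≡ C n) r

-- α(A) = 0 : the sup of {r : partially computable at density r} is 0
-- (0 is always in the set via the empty function; the set is downward closed)
AlphaIsZero : (ℕ → Bool) → Set
AlphaIsZero A = ∀ (r : ℚ) → 0ℚ <ℚ r → ¬ PartiallyComputableAt A r

-- γ(A) = q : sup of the downward-closed set {r : coarsely computable at density r} is q
GammaIs : (ℕ → Bool) → ℚ → Set
GammaIs A q = (∀ (r : ℚ) → r <ℚ q → CoarselyComputableAt A r) ×
              (∀ (r : ℚ) → q <ℚ r → ¬ CoarselyComputableAt A r)

-- Cut ω into blocks [aₖ, aₖ₊₁) with a₀ = 0 and aₖ₊₁ = 2(k+1)(aₖ+1), so every aₖ is even and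
-- D·aₖ < aₖ₊₁ for every fixed D and all large k, and put A(n) = B(k) xor (n mod 2) on block k.
-- Then B(k) = A(aₖ), so A ≡T B; and A differs from ∅ on exactly one of 2i, 2i+1, so γ(A) ≥ 1/2.
-- If a partial computable φ correct on A had a domain of positive lower density, that domain would
-- meet every late block, because the earlier blocks carry vanishing density; dovetailing φ over
-- block k until it halts somewhere and correcting by the parity would compute B(k). Likewise a
-- computable C agreeing with A on a set of lower density > 1/2 agrees with A on most of every late
-- block, and a majority vote over block k computes B(k). In both cases B would be computable.
-- The dovetailing needs a step-bounded interpreter for the oracle μ-recursive codes that is itself
-- a total program.

module Submission where

open import Defs
open import Data.Bool using (Bool; true; false; not; _xor_)
open import Data.Bool.Properties using (not-involutive; not-distribʳ-xor; xor-assoc; xor-same; xor-identityʳ)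
open import Data.Empty using (⊥-elim)
open import Data.Fin using (Fin; zero; suc; _↑ʳ_)
import Data.Integer.Properties as ℤP
open import Data.List using (List; []; _∷_; length)
open import Data.List.Relation.Unary.All as All using (All; []; _∷_)
open import Data.List.Relation.Unary.AllPairs using ([]; _∷_)
open import Data.List.Relation.Unary.Unique.Propositional using (Unique)
open import Data.Nat as ℕ using (ℕ; zero; suc; _+_; _*_; _∸_; _≤_; _<_; s≤s; z≤n; _⊔_)
import Data.Nat.Properties as ℕP
open import Data.Nat.Coprimality using (Coprime; 1-coprimeTo) renaming (sym to coprime-sym)
open import Data.Nat.Tactic.RingSolver using (solve-∀)
open import Data.Product using (Σ; _×_; _,_; proj₁; proj₂; map₂)
open import Data.Rational as ℚ using (ℚ; mkℚ; ½; 0ℚ)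
import Data.Rational.Properties as ℚP
open import Algebra.Properties.AbelianGroup ℚP.+-0-abelianGroup using (⁻¹-anti-homo‿-; xyx⁻¹≈y)
import Data.Rational.Unnormalised as ℚᵘ
import Data.Rational.Unnormalised.Properties as ℚᵘP
open import Data.Sum using (_⊎_; inj₁; inj₂; [_,_]′)
open import Data.Vec using (Vec; []; _∷_; _++_; lookup; tabulate; map; head; tail)
import Data.Vec.Properties as VP
open import Function using (_∘_; id)
open import Function.Bundles using (_⇔_; mk⇔; Equivalence)
open import Relation.Binary using (tri<; tri≈; tri>)
open import Relation.Binary.PropositionalEquality
open import Relation.Nullary using (¬_; yes; no)

module Density where

  open import Data.Integer as ℤ using (+_; -[1+_])

  ℕtoℚ≡mkℚ : ∀ n → ℕtoℚ n ≡ mkℚ (+ n) 0 (coprime-sym (1-coprimeTo n))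
  ℕtoℚ≡mkℚ n = ℚP.↥p/↧p≡p _

  0≤ℕtoℚ : ∀ n → 0ℚ ℚ.≤ ℕtoℚ n
  0≤ℕtoℚ n rewrite ℕtoℚ≡mkℚ n = ℚP.nonNegative⁻¹ _

  nonPos*ℕtoℚ≤ℕtoℚ : ∀ q N L → q ℚ.≤ 0ℚ → q ℚ.* ℕtoℚ N ℚ.≤ ℕtoℚ L
  nonPos*ℕtoℚ≤ℕtoℚ q N L q≤0 = begin
    q ℚ.* ℕtoℚ N   ≤⟨ ℚP.*-monoʳ-≤-nonNeg (ℕtoℚ N) {{nonNeg}} q≤0 ⟩
    0ℚ ℚ.* ℕtoℚ N  ≡⟨ ℚP.*-zeroˡ (ℕtoℚ N) ⟩
    0ℚ             ≤⟨ 0≤ℕtoℚ L ⟩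
    ℕtoℚ L         ∎
    where
    open ℚP.≤-Reasoning
    nonNeg : ℚ.NonNegative (ℕtoℚ N)
    nonNeg rewrite ℕtoℚ≡mkℚ N = _

  *ℕtoℚ≤ℕtoℚ⇔ : ∀ p d .(c : Coprime p (suc d)) N L →
    (mkℚ (+ p) d c ℚ.* ℕtoℚ N ℚ.≤ ℕtoℚ L) ⇔ (p * N ≤ L * suc d)
  *ℕtoℚ≤ℕtoℚ⇔ p d c N L rewrite ℕtoℚ≡mkℚ N | ℕtoℚ≡mkℚ L = mk⇔
    (λ h → toℕ (ℚᵘP.drop-*≤* (ℚᵘP.≤-respˡ-≃ (ℚP.toℚᵘ-homo-* q N/1) (ℚP.toℚᵘ-mono-≤ h))))
    (λ h → ℚP.toℚᵘ-cancel-≤ (ℚᵘP.≤-respˡ-≃ (ℚᵘP.≃-sym (ℚP.toℚᵘ-homo-* q N/1)) (ℚᵘ.*≤* (fromℕ h))))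
    where
    q = mkℚ (+ p) d c
    N/1 = mkℚ (+ N) 0 (coprime-sym (1-coprimeTo N))
    lhs : + p ℤ.* + N ℤ.* + 1 ≡ + (p * N)
    lhs = trans (ℤP.*-identityʳ _) (sym (ℤP.pos-* p N))
    rhs : + L ℤ.* + (suc d * 1) ≡ + (L * suc d)
    rhs = trans (sym (ℤP.pos-* L _)) (cong (λ x → + (L * x)) (ℕP.*-identityʳ (suc d)))
    toℕ : + p ℤ.* + N ℤ.* + 1 ℤ.≤ + L ℤ.* + (suc d * 1) → p * N ≤ L * suc d
    toℕ h = ℤP.drop‿+≤+ (subst₂ ℤ._≤_ lhs rhs h)
    fromℕ : p * N ≤ L * suc d → + p ℤ.* + N ℤ.* + 1 ℤ.≤ + L ℤ.* + (suc d * 1)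
    fromℕ h = subst₂ ℤ._≤_ (sym lhs) (sym rhs) (ℤ.+≤+ h)

  private
    pos*pos<pos*pos⇒ : ∀ a b c d → + a ℤ.* + b ℤ.< + c ℤ.* + d → a * b < c * d
    pos*pos<pos*pos⇒ a b c d h = ℤP.drop‿+<+ (subst₂ ℤ._<_ (sym (ℤP.pos-* a b)) (sym (ℤP.pos-* c d)) h)

  0<q⇒∃[D]N≤D*L : ∀ q → 0ℚ ℚ.< q →
    Σ ℕ λ D → ∀ N L → q ℚ.* ℕtoℚ N ℚ.≤ ℕtoℚ L → N ≤ D * L
  0<q⇒∃[D]N≤D*L (mkℚ -[1+ _ ] _ _) (ℚ.*<* ())
  0<q⇒∃[D]N≤D*L (mkℚ (+ zero) _ _) (ℚ.*<* (ℤ.+<+ ()))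
  0<q⇒∃[D]N≤D*L (mkℚ (+ suc p) d c) _ = suc d , λ N L h → begin
    N           ≤⟨ ℕP.m≤m+n N (p * N) ⟩
    suc p * N   ≤⟨ Equivalence.to (*ℕtoℚ≤ℕtoℚ⇔ (suc p) d c N L) h ⟩
    L * suc d   ≡⟨ ℕP.*-comm L (suc d) ⟩
    suc d * L   ∎
    where open ℕP.≤-Reasoning

  ½<q⇒∃[D][1+D]N≤2DL : ∀ q → ½ ℚ.< q →
    Σ ℕ λ D → ∀ N L → q ℚ.* ℕtoℚ N ℚ.≤ ℕtoℚ L → suc D * N ≤ 2 * (D * L)
  ½<q⇒∃[D][1+D]N≤2DL (mkℚ -[1+ _ ] _ _) (ℚ.*<* ())
  ½<q⇒∃[D][1+D]N≤2DL (mkℚ (+ p) d c) ½<q = suc d , λ N L h → begin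
    suc (suc d) * N  ≤⟨ ℕP.*-monoˡ-≤ N 2+d≤2p ⟩
    p * 2 * N        ≡⟨ rearrange p N ⟩
    2 * (p * N)      ≤⟨ ℕP.*-monoʳ-≤ 2 (Equivalence.to (*ℕtoℚ≤ℕtoℚ⇔ p d c N L) h) ⟩
    2 * (L * suc d)  ≡⟨ cong (2 *_) (ℕP.*-comm L (suc d)) ⟩
    2 * (suc d * L)  ∎
    where
    open ℕP.≤-Reasoning
    2+d≤2p : suc (suc d) ≤ p * 2
    2+d≤2p = subst (_< p * 2) (ℕP.*-identityˡ (suc d)) (pos*pos<pos*pos⇒ 1 (suc d) p 2 (ℚP.drop-*<* ½<q))
    rearrange : ∀ p N → p * 2 * N ≡ 2 * (p * N)
    rearrange = solve-∀

  q<½⇒∃[D]q*M≤c : ∀ q → q ℚ.< ½ →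
    Σ ℕ λ D → ∀ M c → D ≤ M → M ≤ suc (2 * c) → q ℚ.* ℕtoℚ M ℚ.≤ ℕtoℚ c
  q<½⇒∃[D]q*M≤c q@(mkℚ -[1+ _ ] _ _) _ = 0 , λ M c _ _ → nonPos*ℕtoℚ≤ℕtoℚ q M c (ℚ.*≤* ℤ.-≤+)
  q<½⇒∃[D]q*M≤c q@(mkℚ (+ zero) _ _) _ = 0 , λ M c _ _ → nonPos*ℕtoℚ≤ℕtoℚ q M c (ℚ.*≤* (ℤ.+≤+ z≤n))
  q<½⇒∃[D]q*M≤c (mkℚ (+ suc k) d cp) q<½ = suc d , λ M c D≤M M≤1+2c →
    Equivalence.from (*ℕtoℚ≤ℕtoℚ⇔ (suc k) d cp M c)
      (ℕP.*-cancelˡ-≤ 2 (ℕP.+-cancelˡ-≤ M _ _ (begin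
        M + 2 * (suc k * M)    ≡⟨ rearrangeˡ (suc k) M ⟩
        suc (suc k * 2) * M    ≤⟨ ℕP.*-monoˡ-≤ M 2p<D ⟩
        suc d * M              ≤⟨ ℕP.*-monoʳ-≤ (suc d) M≤1+2c ⟩
        suc d * suc (2 * c)    ≡⟨ rearrangeʳ (suc d) c ⟩
        suc d + 2 * (c * suc d) ≤⟨ ℕP.+-monoˡ-≤ _ D≤M ⟩
        M + 2 * (c * suc d)    ∎)))
    where
    open ℕP.≤-Reasoning
    2p<D : suc k * 2 < suc d
    2p<D = subst (suc k * 2 <_) (ℕP.*-identityˡ (suc d)) (pos*pos<pos*pos⇒ (suc k) 2 1 (suc d) (ℚP.drop-*<* q<½))
    rearrangeˡ : ∀ p M → M + 2 * (p * M) ≡ suc (p * 2) * M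
    rearrangeˡ = solve-∀
    rearrangeʳ : ∀ D c → D * suc (2 * c) ≡ D + 2 * (c * D)
    rearrangeʳ = solve-∀

  r-ε<r : ∀ r ε → 0ℚ ℚ.< ε → r ℚ.- ε ℚ.< r
  r-ε<r r ε 0<ε = subst (r ℚ.- ε ℚ.<_) (ℚP.+-identityʳ r) (ℚP.+-monoʳ-< r (ℚP.neg-antimono-< 0<ε))

  lowerDensity⇒eventually-ρ≥ : ∀ {D r m} → LowerDensityAtLeast D r → m ℚ.< r →
    Σ ℕ λ N → ∀ n → N < n → RhoAtLeast D n m
  lowerDensity⇒eventually-ρ≥ {D} {r} {m} dens m<r =
    map₂ (λ { ρ≥ (suc n) (s≤s N≤n) → subst (RhoAtLeast D (suc n)) r-[r-m]≡m (ρ≥ n N≤n) }) (dens (r ℚ.- m) 0<r-m)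
    where
    0<r-m : 0ℚ ℚ.< r ℚ.- m
    0<r-m = subst (ℚ._< r ℚ.- m) (ℚP.+-inverseʳ m) (ℚP.+-monoˡ-< (ℚ.- m) m<r)
    r-[r-m]≡m : r ℚ.- (r ℚ.- m) ≡ m
    r-[r-m]≡m = begin
      r ℚ.- (r ℚ.- m)    ≡⟨ cong (r ℚ.+_) (⁻¹-anti-homo‿- r m) ⟩
      r ℚ.+ (m ℚ.- r)    ≡⟨ sym (ℚP.+-assoc r m (ℚ.- r)) ⟩
      r ℚ.+ m ℚ.- r      ≡⟨ xyx⁻¹≈y r m ⟩
      m                  ∎
      where open ≡-Reasoning

module Counting where

  sumBelow : (ℕ → ℕ) → ℕ → ℕ
  sumBelow f zero    = 0
  sumBelow f (suc n) = sumBelow f n + f n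

  sumBelow-cong : ∀ {f g} n → (∀ j → j < n → f j ≡ g j) → sumBelow f n ≡ sumBelow g n
  sumBelow-cong zero    f≡g = refl
  sumBelow-cong (suc n) f≡g =
    cong₂ _+_ (sumBelow-cong n (λ j j<n → f≡g j (ℕP.m<n⇒m<1+n j<n))) (f≡g n (ℕP.n<1+n n))

  sumBelow-+ : ∀ f g n → sumBelow (λ j → f j + g j) n ≡ sumBelow f n + sumBelow g n
  sumBelow-+ f g zero    = refl
  sumBelow-+ f g (suc n) rewrite sumBelow-+ f g n = interchange (sumBelow f n) (sumBelow g n) (f n) (g n)
    where
    interchange : ∀ a b c d → a + b + (c + d) ≡ a + c + (b + d)
    interchange = solve-∀

  sumBelow-1 : ∀ n → sumBelow (λ _ → 1) n ≡ n
  sumBelow-1 zero    = refl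
  sumBelow-1 (suc n) = trans (cong (_+ 1) (sumBelow-1 n)) (ℕP.+-comm n 1)

  sumBelow-++ : ∀ f m n → sumBelow f (m + n) ≡ sumBelow f m + sumBelow (λ j → f (m + j)) n
  sumBelow-++ f m zero    = trans (cong (sumBelow f) (ℕP.+-identityʳ m)) (sym (ℕP.+-identityʳ _))
  sumBelow-++ f m (suc n) rewrite ℕP.+-suc m n | sumBelow-++ f m n = ℕP.+-assoc (sumBelow f m) _ _

  count : (ℕ → Bool) → ℕ → ℕ
  count p = sumBelow (bit ∘ p)

  count≤ : ∀ p n → count p n ≤ n
  count≤ p zero    = z≤n
  count≤ p (suc n) = ℕP.≤-trans (ℕP.+-mono-≤ (count≤ p n) (bit≤1 (p n))) (ℕP.≤-reflexive (ℕP.+-comm n 1))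
    where
    bit≤1 : ∀ b → bit b ≤ 1
    bit≤1 false = z≤n
    bit≤1 true  = s≤s z≤n

  private
    remove : ℕ → List ℕ → List ℕ
    remove m [] = []
    remove m (x ∷ xs) with x ℕP.≟ m
    ... | yes _ = remove m xs
    ... | no  _ = x ∷ remove m xs

    remove-All : ∀ {P : ℕ → Set} m {xs} → All P xs → All P (remove m xs)
    remove-All m {[]}     []         = []
    remove-All m {x ∷ xs} (px ∷ pxs) with x ℕP.≟ m
    ... | yes _ = remove-All m pxs
    ... | no  _ = px ∷ remove-All m pxs

    remove-Unique : ∀ m {xs} → Unique xs → Unique (remove m xs)
    remove-Unique m {[]}     []         = []
    remove-Unique m {x ∷ xs} (x∉ ∷ uxs) with x ℕP.≟ m
    ... | yes _ = remove-Unique m uxs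
    ... | no  _ = remove-All m x∉ ∷ remove-Unique m uxs

    remove-absent : ∀ m {xs} → All (_≢ m) xs → length (remove m xs) ≡ length xs
    remove-absent m {[]}     []         = refl
    remove-absent m {x ∷ xs} (x≢m ∷ hs) with x ℕP.≟ m
    ... | yes x≡m = ⊥-elim (x≢m x≡m)
    ... | no  _   = cong suc (remove-absent m hs)

    remove-length : ∀ m {xs} → Unique xs → length xs ≤ suc (length (remove m xs))
    remove-length m {[]}     []         = z≤n
    remove-length m {x ∷ xs} (x∉ ∷ uxs) with x ℕP.≟ m
    ... | yes refl = s≤s (ℕP.≤-reflexive (sym (remove-absent x (All.map (λ x≢y → x≢y ∘ sym) x∉))))
    ... | no  _    = s≤s (remove-length m uxs)

    remove-below : ∀ {P : ℕ → Set} m {xs} → All (λ x → x < suc m × P x) xs → All (λ x → x < m × P x) (remove m xs)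
    remove-below m {[]}     []                 = []
    remove-below m {x ∷ xs} ((x<1+m , px) ∷ hs) with x ℕP.≟ m
    ... | yes _   = remove-below m hs
    ... | no  x≢m = (ℕP.≤∧≢⇒< (ℕP.≤-pred x<1+m) x≢m , px) ∷ remove-below m hs

  length≤count : ∀ p n {xs} → Unique xs → All (λ x → x < n × p x ≡ true) xs → length xs ≤ count p n
  length≤count p zero    {[]}    _    _                = z≤n
  length≤count p zero    {_ ∷ _} _    ((() , _) ∷ _)
  length≤count p (suc m) {xs}    uxs hs with p m in pm
  ... | true  = begin
    length xs                          ≤⟨ remove-length m uxs ⟩
    suc (length (remove m xs))         ≤⟨ s≤s (length≤count p m (remove-Unique m uxs) (remove-below m hs)) ⟩
    suc (count p m)                    ≡⟨ ℕP.+-comm 1 (count p m) ⟩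
    count p m + 1                      ∎
    where open ℕP.≤-Reasoning
  ... | false = begin
    length xs                          ≡⟨ remove-absent m m∉xs ⟨
    length (remove m xs)               ≤⟨ length≤count p m (remove-Unique m uxs) (remove-below m hs) ⟩
    count p m                          ≡⟨ ℕP.+-identityʳ (count p m) ⟨
    count p m + 0                      ∎
    where
    open ℕP.≤-Reasoning
    m∉xs : All (_≢ m) xs
    m∉xs = All.map (λ { (_ , px) refl → false≢true (trans (sym pm) px) }) hs
      where
      false≢true : false ≢ true
      false≢true ()

  length≤bound : ∀ n {xs} → Unique xs → All (_< n) xs → length xs ≤ n
  length≤bound n uxs hs = ℕP.≤-trans (length≤count (λ _ → true) n uxs (All.map (_, refl) hs)) (count≤ _ n)

  listing : (ℕ → Bool) → ℕ → List ℕ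
  listing p zero = []
  listing p (suc n) with p n
  ... | true  = n ∷ listing p n
  ... | false = listing p n

  listing-spec : ∀ p n → Unique (listing p n) × All (λ x → x < n × p x ≡ true) (listing p n)
                          × length (listing p n) ≡ count p n
  listing-spec p zero = [] , [] , refl
  listing-spec p (suc n) with p n in pn | listing-spec p n
  ... | true  | u , hs , len =
    All.map (λ { (x<n , _) refl → ℕP.<-irrefl refl x<n }) hs ∷ u ,
    (ℕP.n<1+n n , pn) ∷ All.map (λ { (x<n , px) → ℕP.m<n⇒m<1+n x<n , px }) hs ,
    trans (cong suc len) (ℕP.+-comm 1 (count p n))
  ... | false | u , hs , len =
    u , All.map (λ { (x<n , px) → ℕP.m<n⇒m<1+n x<n , px }) hs , trans len (sym (ℕP.+-identityʳ _))

  length>⇒∃≥ : ∀ {P : ℕ → Set} M {xs} → Unique xs → All P xs → M < length xs → Σ ℕ λ x → M ≤ x × P x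
  length>⇒∃≥ {P} M uxs pxs M<len =
    [ id , (λ below → ⊥-elim (ℕP.<⇒≱ M<len (length≤bound M uxs below))) ]′ (split pxs)
    where
    split : ∀ {ys} → All P ys → (Σ ℕ λ x → M ≤ x × P x) ⊎ All (_< M) ys
    split {[]}     []         = inj₂ []
    split {x ∷ ys} (px ∷ pxs) with M ℕP.≤? x | split pxs
    ... | yes M≤x | _          = inj₁ (x , M≤x , px)
    ... | no  _   | inj₁ found = inj₁ found
    ... | no  M≰x | inj₂ below = inj₂ (ℕP.≰⇒> M≰x ∷ below)

module Arithmetic where

  sg : ℕ → ℕ
  sg zero    = 0
  sg (suc _) = 1

  δ : ℕ → ℕ → ℕ
  δ zero    zero    = 1
  δ zero    (suc _) = 0
  δ (suc _) zero    = 0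
  δ (suc x) (suc y) = δ x y

  δ-refl : ∀ x → δ x x ≡ 1
  δ-refl zero    = refl
  δ-refl (suc x) = δ-refl x

  δ-≢ : ∀ {x y} → x ≢ y → δ x y ≡ 0
  δ-≢ {zero}  {zero}  x≢y = ⊥-elim (x≢y refl)
  δ-≢ {zero}  {suc _} _   = refl
  δ-≢ {suc _} {zero}  _   = refl
  δ-≢ {suc x} {suc y} x≢y = δ-≢ (x≢y ∘ cong suc)

  1∸[∣x-y∣]≡δ : ∀ x y → 1 ∸ ((x ∸ y) + (y ∸ x)) ≡ δ x y
  1∸[∣x-y∣]≡δ zero    zero    = refl
  1∸[∣x-y∣]≡δ zero    (suc y) = ℕP.0∸n≡0 y
  1∸[∣x-y∣]≡δ (suc x) zero    = ℕP.0∸n≡0 (x + 0)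
  1∸[∣x-y∣]≡δ (suc x) (suc y) = 1∸[∣x-y∣]≡δ x y

  1∸δ-bit : ∀ b c → 1 ∸ δ (bit b) (bit c) ≡ bit (b xor c)
  1∸δ-bit false false = refl
  1∸δ-bit false true  = refl
  1∸δ-bit true  false = refl
  1∸δ-bit true  true  = refl

  -- The least y < b with q y ≡ 0, or b if there is none, written so that it is primitive recursive.
  least : (ℕ → ℕ) → ℕ → ℕ
  least q zero    = 0
  least q (suc b) = least q b + δ (least q b) b * sg (q b)

  NoZeroBelow : (ℕ → ℕ) → ℕ → Set
  NoZeroBelow q y = ∀ z → z < y → q z ≢ 0

  data Least (q : ℕ → ℕ) (b y : ℕ) : Set where
    none  : y ≡ b → NoZeroBelow q b → Least q b y
    found : y < b → q y ≡ 0 → NoZeroBelow q y → Least q b y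

  least-suc-< : ∀ {q b} → least q b < b → least q (suc b) ≡ least q b
  least-suc-< {q} {b} lt = begin
    least q b + δ (least q b) b * sg (q b)  ≡⟨ cong (λ d → least q b + d * sg (q b)) (δ-≢ (ℕP.<⇒≢ lt)) ⟩
    least q b + 0                          ≡⟨ ℕP.+-identityʳ _ ⟩
    least q b                              ∎
    where open ≡-Reasoning

  least-suc-≡ : ∀ {q b} → least q b ≡ b → least q (suc b) ≡ b + sg (q b)
  least-suc-≡ {q} {b} eq = begin
    least q b + δ (least q b) b * sg (q b)  ≡⟨ cong (λ y → y + δ y b * sg (q b)) eq ⟩
    b + δ b b * sg (q b)                    ≡⟨ cong (λ d → b + d * sg (q b)) (δ-refl b) ⟩
    b + 1 * sg (q b)                        ≡⟨ cong (b +_) (ℕP.*-identityˡ (sg (q b))) ⟩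
    b + sg (q b)                            ∎
    where open ≡-Reasoning

  least-spec : ∀ q b → Least q b (least q b)
  least-spec q zero = none refl (λ _ ())
  least-spec q (suc b) with least-spec q b
  ... | found y<b qy≡0 below =
    subst (Least q (suc b)) (sym (least-suc-< y<b)) (found (ℕP.m<n⇒m<1+n y<b) qy≡0 below)
  ... | none y≡b below = extend (q b) refl
    where
    least≡ : ∀ {v} → q b ≡ v → least q (suc b) ≡ b + sg v
    least≡ qb = trans (least-suc-≡ y≡b) (cong (λ v → b + sg v) qb)
    extend : ∀ v → q b ≡ v → Least q (suc b) (least q (suc b))
    extend zero qb =
      subst (Least q (suc b)) (sym (trans (least≡ qb) (ℕP.+-identityʳ b))) (found (ℕP.n<1+n b) qb below)
    extend (suc _) qb = none (trans (least≡ qb) (ℕP.+-comm b 1)) below′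
      where
      below′ : NoZeroBelow q (suc b)
      below′ z z<1+b with ℕP.m≤n⇒m<n∨m≡n (ℕP.≤-pred z<1+b)
      ... | inj₁ z<b  = below z z<b
      ... | inj₂ refl = λ qz≡0 → ℕP.1+n≢0 (trans (sym qb) qz≡0)

  least-unique : ∀ {q b y} → y < b → q y ≡ 0 → NoZeroBelow q y → least q b ≡ y
  least-unique {q} {b} {y} y<b qy≡0 below with least-spec q b
  ... | none _ noZero = ⊥-elim (noZero y y<b qy≡0)
  ... | found _ qℓ≡0 belowℓ with ℕP.<-cmp (least q b) y
  ...   | tri< ℓ<y _ _ = ⊥-elim (below _ ℓ<y qℓ≡0)
  ...   | tri≈ _ ℓ≡y _ = ℓ≡y
  ...   | tri> _ _ y<ℓ = ⊥-elim (belowℓ y y<ℓ qy≡0)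

  least-< : ∀ {q b y} → y < b → q y ≡ 0 → least q b < b
  least-< {q} {b} {y} y<b qy≡0 with least-spec q b
  ... | none _ noZero = ⊥-elim (noZero y y<b qy≡0)
  ... | found ℓ<b _ _ = ℓ<b

  least-found : ∀ q b → least q b < b → q (least q b) ≡ 0
  least-found q b ℓ<b with least-spec q b
  ... | none ℓ≡b _ = ⊥-elim (ℕP.<⇒≢ ℓ<b ℓ≡b)
  ... | found _ qℓ≡0 _ = qℓ≡0

  least-below : ∀ q b → NoZeroBelow q (least q b)
  least-below q b with least-spec q b
  ... | none ℓ≡b below = subst (NoZeroBelow q) (sym ℓ≡b) below
  ... | found _ _ below = below

  least-cong : ∀ {q q′} → q ≗ q′ → ∀ b → least q b ≡ least q′ b
  least-cong q≗q′ zero = refl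
  least-cong q≗q′ (suc b) rewrite least-cong q≗q′ b | q≗q′ b = refl

  product : ∀ {m} → Vec ℕ m → ℕ
  product []       = 1
  product (x ∷ xs) = x * product xs

  commonBound : ∀ (P : ℕ → ℕ → Set) → (∀ {z s s′} → s ≤ s′ → P z s → P z s′) →
                ∀ n → (∀ z → z < n → Σ ℕ (P z)) → Σ ℕ λ S → ∀ z → z < n → P z S
  commonBound P mono zero    bounds = 0 , λ _ ()
  commonBound P mono (suc n) bounds with commonBound P mono n (λ z z<n → bounds z (ℕP.m<n⇒m<1+n z<n))
                                       | bounds n (ℕP.n<1+n n)
  ... | S , below | s , at = S ⊔ s , λ z z<1+n → case z (ℕP.m≤n⇒m<n∨m≡n (ℕP.≤-pred z<1+n))
    where
    case : ∀ z → z < n ⊎ z ≡ n → P z (S ⊔ s)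
    case z (inj₁ z<n) = mono (ℕP.m≤m⊔n S s) (below z z<n)
    case z (inj₂ refl) = mono (ℕP.m≤n⊔m S s) at

module Programs where

  open Counting using (sumBelow)
  open Arithmetic

  private
    variable
      O : ℕ → Bool
      k m : ℕ

  record Program (O : ℕ → Bool) (k : ℕ) : Set where
    constructor program
    field
      code : Code k
      ⟦_⟧  : Vec ℕ k → ℕ
      eval : ∀ xs → Eval O code xs (⟦_⟧ xs)
  open Program public

  ≤T⇒Program : ∀ {A} → A ≤T O → Program O 1
  ≤T⇒Program {A = A} (c , correct) = program c (λ { (n ∷ []) → bit (A n) }) (λ { (n ∷ []) → correct n })

  withSemantics : (t : Program O k) (f : Vec ℕ k → ℕ) → ⟦ t ⟧ ≗ f → Program O k
  withSemantics t f t≗f = program (code t) f (λ xs → subst (Eval _ (code t) xs) (t≗f xs) (eval t xs))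

  ⟦_⟧* : Vec (Program O k) m → Vec ℕ k → Vec ℕ m
  ⟦ ts ⟧* xs = map (λ t → ⟦ t ⟧ xs) ts

  evalAll : (ts : Vec (Program O k) m) (xs : Vec ℕ k) → EvalAll O (map code ts) xs (⟦ ts ⟧* xs)
  evalAll []       xs = ea-[]
  evalAll (t ∷ ts) xs = ea-∷ (eval t xs) (evalAll ts xs)

  zeroₚ : Program O k
  zeroₚ = program zro (λ _ → 0) (λ _ → e-zro)

  projₚ : Fin k → Program O k
  projₚ i = program (proj i) (λ xs → lookup xs i) (λ _ → e-proj i)

  compₚ : Program O m → Vec (Program O k) m → Program O k
  compₚ f gs = program (comp (code f) (map code gs)) (λ xs → ⟦ f ⟧ (⟦ gs ⟧* xs))
                       (λ xs → e-comp (evalAll gs xs) (eval f (⟦ gs ⟧* xs)))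

  sucₚ : Program O k → Program O k
  sucₚ t = program (comp sucC (code t ∷ [])) (λ xs → suc (⟦ t ⟧ xs))
                   (λ xs → e-comp (ea-∷ (eval t xs) ea-[]) e-suc)

  oracleₚ : Program O k → Program O k
  oracleₚ {O} t = program (comp orc (code t ∷ [])) (λ xs → bit (O (⟦ t ⟧ xs)))
                          (λ xs → e-comp (ea-∷ (eval t xs) ea-[]) e-orc)

  rec : (Vec ℕ k → ℕ) → (Vec ℕ (suc (suc k)) → ℕ) → ℕ → Vec ℕ k → ℕ
  rec f g zero    xs = f xs
  rec f g (suc y) xs = g (y ∷ rec f g y xs ∷ xs)

  precₚ : Program O k → Program O (suc (suc k)) → Program O (suc k)
  precₚ {O} {k} f g = program (prec (code f) (code g)) (λ { (y ∷ xs) → rec ⟦ f ⟧ ⟦ g ⟧ y xs })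
                              (λ { (y ∷ xs) → evalRec y xs })
    where
    evalRec : ∀ y xs → Eval O (prec (code f) (code g)) (y ∷ xs) (rec ⟦ f ⟧ ⟦ g ⟧ y xs)
    evalRec zero    xs = e-prec0 (eval f xs)
    evalRec (suc y) xs = e-precS (evalRec y xs) (eval g _)

  dropₚ : ∀ j → Vec (Program O (j + k)) k
  dropₚ j = tabulate (λ i → projₚ (j ↑ʳ i))

  ⟦dropₚ⟧ : ∀ {j} (ys : Vec ℕ j) (xs : Vec ℕ k) → ⟦ dropₚ {O} j ⟧* (ys ++ xs) ≡ xs
  ⟦dropₚ⟧ {j = j} ys xs = begin
    map (λ t → ⟦ t ⟧ (ys ++ xs)) (tabulate (λ i → projₚ (j ↑ʳ i)))  ≡⟨ VP.tabulate-∘ _ _ ⟨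
    tabulate (λ i → lookup (ys ++ xs) (j ↑ʳ i))                     ≡⟨ VP.tabulate-cong (VP.lookup-++ʳ ys xs) ⟩
    tabulate (lookup xs)                                             ≡⟨ VP.tabulate∘lookup xs ⟩
    xs                                                               ∎
    where open ≡-Reasoning

  constₚ : ℕ → Program O k
  constₚ n = withSemantics (numeral n) (λ _ → n) (⟦numeral⟧ n)
    where
    numeral : ℕ → Program _ _
    numeral zero    = zeroₚ
    numeral (suc n) = sucₚ (numeral n)
    ⟦numeral⟧ : ∀ n → ⟦ numeral n ⟧ ≗ (λ _ → n)
    ⟦numeral⟧ zero    xs = refl
    ⟦numeral⟧ (suc n) xs = cong suc (⟦numeral⟧ n xs)

  1ₚ : Program O k
  1ₚ = constₚ 1

  private
    binary : (ℕ → ℕ → ℕ) → Vec ℕ 2 → ℕ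
    binary _⊕_ (y ∷ x ∷ []) = y ⊕ x

    plus₂ : Program O 2
    plus₂ = withSemantics (precₚ (projₚ zero) (sucₚ (projₚ (suc zero)))) (binary _+_)
                          λ { (y ∷ x ∷ []) → ⟦plus₂⟧ y x }
      where
      ⟦plus₂⟧ : ∀ y x → rec (λ xs → lookup xs zero) (λ xs → suc (lookup xs (suc zero))) y (x ∷ []) ≡ y + x
      ⟦plus₂⟧ zero    x = refl
      ⟦plus₂⟧ (suc y) x = cong suc (⟦plus₂⟧ y x)

    times₂ : Program O 2
    times₂ = withSemantics (precₚ zeroₚ (compₚ plus₂ (projₚ (suc (suc zero)) ∷ projₚ (suc zero) ∷ [])))
                           (binary _*_) λ { (y ∷ x ∷ []) → ⟦times₂⟧ y x }
      where
      ⟦times₂⟧ : ∀ y x → rec (λ _ → 0) (λ xs → lookup xs (suc (suc zero)) + lookup xs (suc zero)) y (x ∷ []) ≡ y * x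
      ⟦times₂⟧ zero    x = refl
      ⟦times₂⟧ (suc y) x = cong (x +_) (⟦times₂⟧ y x)

    pred₁ : Program O 1
    pred₁ = withSemantics (precₚ zeroₚ (projₚ zero)) (λ { (y ∷ []) → ℕ.pred y })
                          λ { (zero ∷ []) → refl ; (suc y ∷ []) → refl }

    monus₂ : Program O 2
    monus₂ = withSemantics (precₚ (projₚ zero) (compₚ pred₁ (projₚ (suc zero) ∷ [])))
                           (binary (λ y x → x ∸ y)) λ { (y ∷ x ∷ []) → ⟦monus₂⟧ y x }
      where
      ⟦monus₂⟧ : ∀ y x → rec (λ xs → lookup xs zero) (λ xs → ℕ.pred (lookup xs (suc zero))) y (x ∷ []) ≡ x ∸ y
      ⟦monus₂⟧ zero    x = refl
      ⟦monus₂⟧ (suc y) x = trans (cong ℕ.pred (⟦monus₂⟧ y x)) (ℕP.pred[m∸n]≡m∸[1+n] x y)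

    sg₁ : Program O 1
    sg₁ = withSemantics (precₚ zeroₚ 1ₚ) (λ { (y ∷ []) → sg y })
                        λ { (zero ∷ []) → refl ; (suc y ∷ []) → refl }

  infixl 6 _+ₚ_ _∸ₚ_
  infixl 7 _*ₚ_
  infix  4 _==ₚ_

  _+ₚ_ _*ₚ_ _∸ₚ_ _==ₚ_ : Program O k → Program O k → Program O k
  a +ₚ b = compₚ plus₂ (a ∷ b ∷ [])
  a *ₚ b = compₚ times₂ (a ∷ b ∷ [])
  a ∸ₚ b = compₚ monus₂ (b ∷ a ∷ [])
  a ==ₚ b = withSemantics (1ₚ ∸ₚ ((a ∸ₚ b) +ₚ (b ∸ₚ a))) (λ xs → δ (⟦ a ⟧ xs) (⟦ b ⟧ xs))
                          (λ xs → 1∸[∣x-y∣]≡δ (⟦ a ⟧ xs) (⟦ b ⟧ xs))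

  predₚ sgₚ : Program O k → Program O k
  predₚ a = compₚ pred₁ (a ∷ [])
  sgₚ   a = compₚ sg₁ (a ∷ [])

  productₚ : Vec (Program O k) m → Program O k
  productₚ []       = 1ₚ
  productₚ (t ∷ ts) = t *ₚ productₚ ts

  ⟦productₚ⟧ : (ts : Vec (Program O k) m) (xs : Vec ℕ k) → ⟦ productₚ ts ⟧ xs ≡ product (⟦ ts ⟧* xs)
  ⟦productₚ⟧ []       xs = refl
  ⟦productₚ⟧ (t ∷ ts) xs = cong (⟦ t ⟧ xs *_) (⟦productₚ⟧ ts xs)

  ⟦map-predₚ⟧ : (ts : Vec (Program O k) m) (xs : Vec ℕ k) → ⟦ map predₚ ts ⟧* xs ≡ map ℕ.pred (⟦ ts ⟧* xs)
  ⟦map-predₚ⟧ []       xs = refl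
  ⟦map-predₚ⟧ (t ∷ ts) xs = cong (ℕ.pred (⟦ t ⟧ xs) ∷_) (⟦map-predₚ⟧ ts xs)

  searchₚ : Program O (suc k) → Program O (suc k)
  searchₚ {O} {k} q = withSemantics (precₚ zeroₚ step) (λ { (b ∷ xs) → least (λ y → ⟦ q ⟧ (y ∷ xs)) b })
                                    (λ { (b ∷ xs) → ⟦search⟧ b xs })
    where
    step : Program O (suc (suc k))
    step = projₚ (suc zero) +ₚ (projₚ (suc zero) ==ₚ projₚ zero) *ₚ sgₚ (compₚ q (projₚ zero ∷ dropₚ 2))
    ⟦search⟧ : ∀ b xs → rec (λ _ → 0) ⟦ step ⟧ b xs ≡ least (λ y → ⟦ q ⟧ (y ∷ xs)) b
    ⟦search⟧ zero    xs = refl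
    ⟦search⟧ (suc b) xs rewrite ⟦dropₚ⟧ {O = O} (b ∷ rec (λ _ → 0) ⟦ step ⟧ b xs ∷ []) xs | ⟦search⟧ b xs = refl

  sumₚ : Program O (suc k) → Program O (suc k)
  sumₚ {O} {k} h = withSemantics (precₚ zeroₚ step) (λ { (b ∷ xs) → sumBelow (λ j → ⟦ h ⟧ (j ∷ xs)) b })
                                 (λ { (b ∷ xs) → ⟦sum⟧ b xs })
    where
    step : Program O (suc (suc k))
    step = projₚ (suc zero) +ₚ compₚ h (projₚ zero ∷ dropₚ 2)
    ⟦sum⟧ : ∀ b xs → rec (λ _ → 0) ⟦ step ⟧ b xs ≡ sumBelow (λ j → ⟦ h ⟧ (j ∷ xs)) b
    ⟦sum⟧ zero    xs = refl
    ⟦sum⟧ (suc b) xs rewrite ⟦sum⟧ b xs | ⟦dropₚ⟧ {O = O} (b ∷ sumBelow (λ j → ⟦ h ⟧ (j ∷ xs)) b ∷ []) xs = refl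

  μ-halts : (h : Program O (suc k)) (xs : Vec ℕ k) {s : ℕ} → ⟦ h ⟧ (s ∷ xs) ≡ 0 →
            Σ ℕ λ y → ⟦ h ⟧ (y ∷ xs) ≡ 0 × Eval O (mu (code h)) xs y
  μ-halts {O} h xs {s} hs≡0 with least-spec (λ z → ⟦ h ⟧ (z ∷ xs)) (suc s)
  ... | none _ noZero       = ⊥-elim (noZero s (ℕP.n<1+n s) hs≡0)
  ... | found _ hy≡0 below =
    _ , hy≡0 , e-mu (subst (Eval O (code h) _) hy≡0 (eval h _)) (λ z z<y → positive z (below z z<y))
    where
    positive : ∀ z → ⟦ h ⟧ (z ∷ xs) ≢ 0 → Σ ℕ λ w → Eval O (code h) (z ∷ xs) (suc w)
    positive z hz≢0 with ⟦ h ⟧ (z ∷ xs) in hz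
    ... | zero  = ⊥-elim (hz≢0 refl)
    ... | suc w = w , subst (Eval O (code h) (z ∷ xs)) hz (eval h (z ∷ xs))

  eventuallyCorrect⇒Computable : ∀ (B : ℕ → Bool) K (c : Code 1) →
    (∀ k → K ≤ k → Eval ∅ c (k ∷ []) (bit (B k))) → Computable B
  eventuallyCorrect⇒Computable B zero    c correct = c , λ k → correct k z≤n
  eventuallyCorrect⇒Computable B (suc K) c correct =
    eventuallyCorrect⇒Computable B K (code patched) λ k K≤k →
      subst (Eval ∅ (code patched) (k ∷ [])) (⟦patched⟧ k K≤k) (eval patched (k ∷ []))
    where
    clamp : Program ∅ 1
    clamp = projₚ zero ∸ₚ constₚ (suc K) +ₚ constₚ (suc K)
    shifted : Program ∅ 1
    shifted = program (comp c (code clamp ∷ [])) (λ { (k ∷ []) → bit (B (k ∸ suc K + suc K)) })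
      (λ { (k ∷ []) → e-comp (ea-∷ (eval clamp (k ∷ [])) ea-[]) (correct _ (ℕP.m≤n+m (suc K) _)) })
    isK : Program ∅ 1
    isK = projₚ zero ==ₚ constₚ K
    patched : Program ∅ 1
    patched = isK *ₚ constₚ (bit (B K)) +ₚ (1ₚ ∸ₚ isK) *ₚ shifted
    ⟦patched⟧ : ∀ k → K ≤ k → ⟦ patched ⟧ (k ∷ []) ≡ bit (B k)
    ⟦patched⟧ k K≤k with ℕP.m≤n⇒m<n∨m≡n K≤k
    ... | inj₂ refl rewrite δ-refl K = trans (ℕP.+-identityʳ _) (ℕP.+-identityʳ _)
    ... | inj₁ K<k rewrite δ-≢ (ℕP.<⇒≢ K<k ∘ sym) | ℕP.m∸n+n≡m K<k = ℕP.+-identityʳ _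

module StepBounded where

  open Arithmetic
  open Programs

  bind : ℕ → (ℕ → ℕ) → ℕ
  bind u h = sg u * h (ℕ.pred u)

  μResult : ℕ → ℕ → ℕ → ℕ
  μResult t s y = sg (s ∸ y) * δ t 1 * suc y

  bind-suc : ∀ u h → bind (suc u) h ≡ h u
  bind-suc u h = ℕP.+-identityʳ (h u)

  bind≡suc : ∀ u h {v} → bind u h ≡ suc v → Σ ℕ λ u′ → u ≡ suc u′ × h u′ ≡ suc v
  bind≡suc (suc u) h eq = u , refl , trans (sym (bind-suc u h)) eq

  product≡suc : ∀ {m} (rs : Vec ℕ m) {w} → product rs ≡ suc w → rs ≡ map suc (map ℕ.pred rs)
  product≡suc []            _  = refl
  product≡suc (zero ∷ rs)   ()
  product≡suc (suc r ∷ rs)  eq with product rs in p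
  ... | suc _ = cong (suc r ∷_) (product≡suc rs p)
  ... | zero  = ⊥-elim (ℕP.0≢1+n (trans (sym (ℕP.*-zeroʳ (suc r))) eq))

  product-map-suc : ∀ {m} (ys : Vec ℕ m) → Σ ℕ λ w → product (map suc ys) ≡ suc w
  product-map-suc []       = 0 , refl
  product-map-suc (y ∷ ys) with product-map-suc ys
  ... | w , p rewrite p = _ , refl

  map-pred-suc : ∀ {m} (ys : Vec ℕ m) → map ℕ.pred (map suc ys) ≡ ys
  map-pred-suc []       = refl
  map-pred-suc (y ∷ ys) = cong (y ∷_) (map-pred-suc ys)

  μResult≡suc : ∀ t s y {v} → μResult t s y ≡ suc v → y < s × t ≡ 1 × y ≡ v
  μResult≡suc t s y eq with s ∸ y in s∸y | t ℕP.≟ 1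
  ... | zero  | _        = ⊥-elim (ℕP.0≢1+n eq)
  ... | suc _ | no  t≢1  = ⊥-elim (ℕP.0≢1+n (trans (cong (λ d → (d + 0) * suc y) (sym (δ-≢ t≢1))) eq))
  ... | suc _ | yes refl =
    ℕP.m∸n≢0⇒n<m (λ s∸y≡0 → ℕP.0≢1+n (trans (sym s∸y≡0) s∸y)) , refl ,
    ℕP.suc-injective (trans (sym (ℕP.+-identityʳ (suc y))) eq)

  μResult-1 : ∀ s y → y < s → μResult 1 s y ≡ suc y
  μResult-1 s y y<s with s ∸ y in s∸y
  ... | zero  = ⊥-elim (ℕP.<⇒≢ (ℕP.m<n⇒0<n∸m y<s) (sym s∸y))
  ... | suc _ = ℕP.+-identityʳ (suc y)

  ∸1≢0 : ∀ r → r ∸ 1 ≢ 0 → Σ ℕ λ w → r ≡ suc (suc w)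
  ∸1≢0 zero          r∸1≢0 = ⊥-elim (r∸1≢0 refl)
  ∸1≢0 (suc zero)    r∸1≢0 = ⊥-elim (r∸1≢0 refl)
  ∸1≢0 (suc (suc w)) _     = w , refl

  module _ (O : ℕ → Bool) where

    -- run c s xs is 0 if c has not halted on xs within s stages, and suc v if it has halted with output v.
    mutual
      run : ∀ {k} → Code k → ℕ → Vec ℕ k → ℕ
      run zro         s xs       = 1
      run sucC        s (x ∷ []) = suc (suc x)
      run (proj i)    s xs       = suc (lookup xs i)
      run orc         s (x ∷ []) = suc (bit (O x))
      run (comp f gs) s xs       = sg (product (run* gs s xs)) * run f s (map ℕ.pred (run* gs s xs))
      run (prec f g)  s (y ∷ xs) = runRec f g s y xs
      run (mu f)      s xs       = μResult (run f s (μCandidate f s xs ∷ xs)) s (μCandidate f s xs)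

      run* : ∀ {k m} → Vec (Code k) m → ℕ → Vec ℕ k → Vec ℕ m
      run* []       s xs = []
      run* (g ∷ gs) s xs = run g s xs ∷ run* gs s xs

      runRec : ∀ {k} → Code k → Code (suc (suc k)) → ℕ → ℕ → Vec ℕ k → ℕ
      runRec f g s zero    xs = run f s xs
      runRec f g s (suc y) xs = bind (runRec f g s y xs) (λ u → run g s (y ∷ u ∷ xs))

      -- The least z < s at which f either has not halted or has returned 0; μResult checks it returned 0.
      μCandidate : ∀ {k} → Code (suc k) → ℕ → Vec ℕ k → ℕ
      μCandidate f s xs = least (λ z → run f s (z ∷ xs) ∸ 1) s

    run-comp : ∀ {k m} (f : Code m) (gs : Vec (Code k) m) {s xs ys} →
               run* gs s xs ≡ map suc ys → run (comp f gs) s xs ≡ run f s ys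
    run-comp f gs {s} {xs} {ys} rs≡ with product-map-suc ys
    ... | w , p rewrite rs≡ | p | map-pred-suc ys = ℕP.+-identityʳ (run f s ys)

    run-comp≡suc : ∀ {k m} (f : Code m) (gs : Vec (Code k) m) {s xs v} → run (comp f gs) s xs ≡ suc v →
                   Σ (Vec ℕ m) λ ys → run* gs s xs ≡ map suc ys × run f s ys ≡ suc v
    run-comp≡suc f gs {s} {xs} eq with product (run* gs s xs) in p
    ... | suc _ = map ℕ.pred (run* gs s xs) , product≡suc _ p , trans (sym (ℕP.+-identityʳ _)) eq

    MuHalts : ∀ {k} → Code (suc k) → ℕ → Vec ℕ k → ℕ → Set
    MuHalts f s xs y = y < s × run f s (y ∷ xs) ≡ 1 × ∀ z → z < y → Σ ℕ λ w → run f s (z ∷ xs) ≡ suc (suc w)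

    run-μ : ∀ {k} (f : Code (suc k)) {s xs y} → MuHalts f s xs y → run (mu f) s xs ≡ suc y
    run-μ f {s} {xs} {y} (y<s , halts , before) = begin
      μResult (run f s (μCandidate f s xs ∷ xs)) s (μCandidate f s xs)
        ≡⟨ cong (λ c → μResult (run f s (c ∷ xs)) s c) candidate ⟩
      μResult (run f s (y ∷ xs)) s y
        ≡⟨ cong (λ t → μResult t s y) halts ⟩
      μResult 1 s y
        ≡⟨ μResult-1 s y y<s ⟩
      suc y
        ∎
      where
      open ≡-Reasoning
      candidate : μCandidate f s xs ≡ y
      candidate = least-unique y<s (cong (_∸ 1) halts) λ z z<y →
        let w , eq = before z z<y in λ r∸1≡0 → ℕP.1+n≢0 (trans (sym (cong (_∸ 1) eq)) r∸1≡0)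

    run-μ≡suc : ∀ {k} (f : Code (suc k)) {s xs v} → run (mu f) s xs ≡ suc v → MuHalts f s xs v
    run-μ≡suc f {s} {xs} eq with μResult≡suc (run f s (μCandidate f s xs ∷ xs)) s (μCandidate f s xs) eq
    ... | y<s , halts , refl = y<s , halts , λ z z<y → ∸1≢0 _ (least-below _ s z z<y)

    mutual
      run-sound : ∀ {k} (c : Code k) s xs {v} → run c s xs ≡ suc v → Eval O c xs v
      run-sound zro         s xs       refl = e-zro
      run-sound sucC        s (x ∷ []) refl = e-suc
      run-sound (proj i)    s xs       refl = e-proj i
      run-sound orc         s (x ∷ []) refl = e-orc
      run-sound (comp f gs) s xs       eq with run-comp≡suc f gs eq
      ... | ys , rs≡ , halts = e-comp (run*-sound gs s xs rs≡) (run-sound f s ys halts)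
      run-sound (prec f g)  s (y ∷ xs) eq = runRec-sound f g s y xs eq
      run-sound (mu f)      s xs       eq with run-μ≡suc f eq
      ... | _ , halts , before =
        e-mu (run-sound f s _ halts) (λ z z<y → let w , eq = before z z<y in w , run-sound f s _ eq)

      run*-sound : ∀ {k m} (gs : Vec (Code k) m) s xs {ys} → run* gs s xs ≡ map suc ys → EvalAll O gs xs ys
      run*-sound []       s xs {[]}     _  = ea-[]
      run*-sound (g ∷ gs) s xs {y ∷ ys} eq =
        ea-∷ (run-sound g s xs (cong head eq)) (run*-sound gs s xs (cong tail eq))

      runRec-sound : ∀ {k} (f : Code k) g s y xs {v} → runRec f g s y xs ≡ suc v → Eval O (prec f g) (y ∷ xs) v
      runRec-sound f g s zero    xs eq = e-prec0 (run-sound f s xs eq)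
      runRec-sound f g s (suc y) xs eq with bind≡suc (runRec f g s y xs) _ eq
      ... | u , prev , step = e-precS (runRec-sound f g s y xs prev) (run-sound g s _ step)

    mutual
      run-mono : ∀ {k} (c : Code k) {s xs v} → run c s xs ≡ suc v → run c (suc s) xs ≡ suc v
      run-mono zro                 eq = eq
      run-mono sucC {xs = _ ∷ []}  eq = eq
      run-mono (proj i)            eq = eq
      run-mono orc  {xs = _ ∷ []}  eq = eq
      run-mono (comp f gs)         eq with run-comp≡suc f gs eq
      ... | ys , rs≡ , halts = trans (run-comp f gs (run*-mono gs rs≡)) (run-mono f halts)
      run-mono (prec f g) {xs = y ∷ xs} eq = runRec-mono f g y eq
      run-mono (mu f) {s} {xs}     eq with run-μ≡suc f eq
      ... | v<s , halts , before =
        run-μ f {suc s} {xs} (ℕP.m<n⇒m<1+n v<s , run-mono f halts , λ z z<v → map₂ (run-mono f) (before z z<v))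

      run*-mono : ∀ {k m} (gs : Vec (Code k) m) {s xs ys} →
                  run* gs s xs ≡ map suc ys → run* gs (suc s) xs ≡ map suc ys
      run*-mono []       {ys = []}     _  = refl
      run*-mono (g ∷ gs) {ys = y ∷ ys} eq =
        cong₂ _∷_ (run-mono g (cong head eq)) (run*-mono gs (cong tail eq))

      runRec-mono : ∀ {k} (f : Code k) g y {s xs v} →
                    runRec f g s y xs ≡ suc v → runRec f g (suc s) y xs ≡ suc v
      runRec-mono f g zero    eq = run-mono f eq
      runRec-mono f g (suc y) {s} {xs} eq with bind≡suc (runRec f g s y xs) _ eq
      ... | u , prev , step rewrite runRec-mono f g y prev =
        trans (bind-suc u (λ u → run g (suc s) (y ∷ u ∷ xs))) (run-mono g step)

    run-mono-≤ : ∀ {k} (c : Code k) {s s′ xs v} → s ≤ s′ → run c s xs ≡ suc v → run c s′ xs ≡ suc v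
    run-mono-≤ c s≤s′ = go (ℕP.≤⇒≤′ s≤s′)
      where
      go : ∀ {s s′ xs v} → s ℕ.≤′ s′ → run c s xs ≡ suc v → run c s′ xs ≡ suc v
      go ℕ.≤′-refl        eq = eq
      go (ℕ.≤′-step s≤′s′) eq = run-mono c (go s≤′s′ eq)

    run*-mono-≤ : ∀ {k m} (gs : Vec (Code k) m) {s s′ xs ys} → s ≤ s′ →
                  run* gs s xs ≡ map suc ys → run* gs s′ xs ≡ map suc ys
    run*-mono-≤ []       {ys = []}     _    _  = refl
    run*-mono-≤ (g ∷ gs) {ys = y ∷ ys} s≤s′ eq =
      cong₂ _∷_ (run-mono-≤ g s≤s′ (cong head eq)) (run*-mono-≤ gs s≤s′ (cong tail eq))

    mutual
      run-complete : ∀ {k} {c : Code k} {xs v} → Eval O c xs v → Σ ℕ λ s → run c s xs ≡ suc v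
      run-complete e-zro      = 0 , refl
      run-complete e-suc      = 0 , refl
      run-complete (e-proj i) = 0 , refl
      run-complete e-orc      = 0 , refl
      run-complete (e-comp {f = f} {gs = gs} ea ef) with run*-complete ea | run-complete ef
      ... | s₁ , rs≡ | s₂ , halts =
        s₁ ⊔ s₂ , trans (run-comp f gs (run*-mono-≤ gs (ℕP.m≤m⊔n s₁ s₂) rs≡))
                        (run-mono-≤ f (ℕP.m≤n⊔m s₁ s₂) halts)
      run-complete (e-prec0 ef) = run-complete ef
      run-complete (e-precS {f = f} {g = g} {xs = xs} {y = y} {u = u} ep eg)
        with run-complete ep | run-complete eg
      ... | s₁ , prev | s₂ , step =
        s₁ ⊔ s₂ , trans (cong (λ r → bind r next) (run-mono-≤ (prec f g) {xs = y ∷ xs} (ℕP.m≤m⊔n s₁ s₂) prev))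
                        (trans (bind-suc u next) (run-mono-≤ g (ℕP.m≤n⊔m s₁ s₂) step))
        where
        next : ℕ → ℕ
        next u = run g (s₁ ⊔ s₂) (y ∷ u ∷ xs)
      run-complete (e-mu {f = f} {xs = xs} {y = y} ef before)
        with run-complete ef
           | commonBound (λ z s → Σ ℕ λ w → run f s (z ∷ xs) ≡ suc (suc w))
                         (λ s≤s′ (w , eq) → w , run-mono-≤ f s≤s′ eq)
                         y (λ z z<y → let w , d = before z z<y ; s , eq = run-complete d in s , w , eq)
      ... | s₀ , halts | F , allBefore =
        S , run-μ f (ℕP.m≤n⊔m (s₀ ⊔ F) (suc y) , run-mono-≤ f s₀≤S halts ,
                     λ z z<y → map₂ (run-mono-≤ f F≤S) (allBefore z z<y))
        where
        S = s₀ ⊔ F ⊔ suc y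
        s₀≤S : s₀ ≤ S
        s₀≤S = ℕP.≤-trans (ℕP.m≤m⊔n s₀ F) (ℕP.m≤m⊔n (s₀ ⊔ F) (suc y))
        F≤S : F ≤ S
        F≤S = ℕP.≤-trans (ℕP.m≤n⊔m s₀ F) (ℕP.m≤m⊔n (s₀ ⊔ F) (suc y))

      run*-complete : ∀ {k m} {gs : Vec (Code k) m} {xs ys} →
                      EvalAll O gs xs ys → Σ ℕ λ s → run* gs s xs ≡ map suc ys
      run*-complete ea-[] = 0 , refl
      run*-complete (ea-∷ {g = g} {gs = gs} e es) with run-complete e | run*-complete es
      ... | s₁ , halts | s₂ , rs≡ =
        s₁ ⊔ s₂ , cong₂ _∷_ (run-mono-≤ g (ℕP.m≤m⊔n s₁ s₂) halts) (run*-mono-≤ gs (ℕP.m≤n⊔m s₁ s₂) rs≡)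

    uncurriedRun : ∀ {k} → Code k → Vec ℕ (suc k) → ℕ
    uncurriedRun c (s ∷ xs) = run c s xs

    mutual
      runₚ : ∀ {k} → Code k → Program O (suc k)
      runₚ c = withSemantics (implementRun c) (uncurriedRun c) (implementRun-correct c)

      runₚ* : ∀ {k m} → Vec (Code k) m → Vec (Program O (suc k)) m
      runₚ* []       = []
      runₚ* (g ∷ gs) = runₚ g ∷ runₚ* gs

      ⟦runₚ*⟧ : ∀ {k m} (gs : Vec (Code k) m) s xs → ⟦ runₚ* gs ⟧* (s ∷ xs) ≡ run* gs s xs
      ⟦runₚ*⟧ []       s xs = refl
      ⟦runₚ*⟧ (g ∷ gs) s xs = cong (run g s xs ∷_) (⟦runₚ*⟧ gs s xs)

      implementRun : ∀ {k} → Code k → Program O (suc k)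
      implementRun zro         = 1ₚ
      implementRun sucC        = sucₚ (sucₚ (projₚ (suc zero)))
      implementRun (proj i)    = sucₚ (projₚ (suc i))
      implementRun orc         = sucₚ (oracleₚ (projₚ (suc zero)))
      implementRun (comp f gs) = sgₚ (productₚ (runₚ* gs)) *ₚ compₚ (runₚ f) (projₚ zero ∷ map predₚ (runₚ* gs))
      implementRun (prec f g)  = compₚ (precₚ (runₚ f) (recStepₚ f g)) (projₚ (suc zero) ∷ projₚ zero ∷ dropₚ 2)
      implementRun (mu f)      = sgₚ (projₚ zero ∸ₚ μCandidateₚ f)
                                 *ₚ (compₚ (runₚ f) (projₚ zero ∷ μCandidateₚ f ∷ dropₚ 1) ==ₚ 1ₚ)
                                 *ₚ sucₚ (μCandidateₚ f)

      recStepₚ : ∀ {k} → Code k → Code (suc (suc k)) → Program O (suc (suc (suc k)))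
      recStepₚ f g = sgₚ (projₚ (suc zero))
                     *ₚ compₚ (runₚ g) (projₚ (suc (suc zero)) ∷ projₚ zero ∷ predₚ (projₚ (suc zero)) ∷ dropₚ 3)

      μCandidateₚ : ∀ {k} → Code (suc k) → Program O (suc k)
      μCandidateₚ f = compₚ (searchₚ (compₚ (runₚ f) (projₚ (suc zero) ∷ projₚ zero ∷ dropₚ 2) ∸ₚ 1ₚ))
                            (projₚ zero ∷ projₚ zero ∷ dropₚ 1)

      ⟦μCandidateₚ⟧ : ∀ {k} (f : Code (suc k)) s xs → ⟦ μCandidateₚ f ⟧ (s ∷ xs) ≡ μCandidate f s xs
      ⟦μCandidateₚ⟧ f s xs rewrite ⟦dropₚ⟧ {O = O} (s ∷ []) xs =
        least-cong (λ z → cong (λ ys → run f s (z ∷ ys) ∸ 1) (⟦dropₚ⟧ {O = O} (z ∷ s ∷ []) xs)) s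

      implementRun-correct : ∀ {k} (c : Code k) → ⟦ implementRun c ⟧ ≗ uncurriedRun c
      implementRun-correct zro         (s ∷ xs)     = refl
      implementRun-correct sucC        (s ∷ x ∷ []) = refl
      implementRun-correct (proj i)    (s ∷ xs)     = refl
      implementRun-correct orc         (s ∷ x ∷ []) = refl
      implementRun-correct (comp f gs) (s ∷ xs)
        rewrite ⟦productₚ⟧ (runₚ* gs) (s ∷ xs) | ⟦map-predₚ⟧ (runₚ* gs) (s ∷ xs) | ⟦runₚ*⟧ gs s xs = refl
      implementRun-correct (prec f g)  (s ∷ y ∷ xs) rewrite ⟦dropₚ⟧ {O = O} (s ∷ y ∷ []) xs = recursion y
        where
        recursion : ∀ y → rec ⟦ runₚ f ⟧ ⟦ recStepₚ f g ⟧ y (s ∷ xs) ≡ runRec f g s y xs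
        recursion zero    = refl
        recursion (suc y) rewrite ⟦dropₚ⟧ {O = O} (y ∷ rec ⟦ runₚ f ⟧ ⟦ recStepₚ f g ⟧ y (s ∷ xs) ∷ s ∷ []) xs
                                | recursion y = refl
      implementRun-correct (mu f)      (s ∷ xs) =
        cong₂ (λ y ys → μResult (run f s (y ∷ ys)) s y) (⟦μCandidateₚ⟧ f s xs) (⟦dropₚ⟧ {O = O} (s ∷ []) xs)

module Blocks where

  open Arithmetic
  open Programs

  blockStart : ℕ → ℕ
  blockStart zero    = 0
  blockStart (suc k) = 2 * (suc k * suc (blockStart k))

  blockStart-< : ∀ k → blockStart k < blockStart (suc k)
  blockStart-< k = ℕP.≤-trans (ℕP.m≤n*m (suc (blockStart k)) (suc k)) (ℕP.m≤n*m (suc k * suc (blockStart k)) 2)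

  blockStart-mono : ∀ {j k} → j ≤ k → blockStart j ≤ blockStart k
  blockStart-mono {j} {k} j≤k = go (ℕP.≤⇒≤′ j≤k)
    where
    go : ∀ {k} → j ℕ.≤′ k → blockStart j ≤ blockStart k
    go ℕ.≤′-refl          = ℕP.≤-refl
    go (ℕ.≤′-step {k} j≤′k) = ℕP.≤-trans (go j≤′k) (ℕP.<⇒≤ (blockStart-< k))

  n≤blockStart : ∀ k → k ≤ blockStart k
  n≤blockStart zero    = z≤n
  n≤blockStart (suc k) = ℕP.≤-trans (s≤s (n≤blockStart k)) (blockStart-< k)

  <blockStart : ∀ {n k} → n ≤ k → n < blockStart (suc k)
  <blockStart {n} {k} n≤k = ℕP.≤-<-trans (ℕP.≤-trans n≤k (n≤blockStart k)) (blockStart-< k)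

  blockStart-growth : ∀ D k → D ≤ 2 * suc k → D * blockStart k < blockStart (suc k)
  blockStart-growth D k D≤2[1+k] = begin-strict
    D * blockStart k                         ≤⟨ ℕP.*-monoˡ-≤ (blockStart k) D≤2[1+k] ⟩
    2 * suc k * blockStart k                 <⟨ ℕP.m<n+m _ {2 * suc k} (s≤s z≤n) ⟩
    2 * suc k + 2 * suc k * blockStart k     ≡⟨ ℕP.*-suc (2 * suc k) (blockStart k) ⟨
    2 * suc k * suc (blockStart k)           ≡⟨ ℕP.*-assoc 2 (suc k) (suc (blockStart k)) ⟩
    blockStart (suc k)                       ∎
    where open ℕP.≤-Reasoning

  late-block : ∀ {N D k} → N + D ≤ k → N < blockStart (suc k) × D * blockStart k < blockStart (suc k)
  late-block {N} {D} {k} N+D≤k =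
    <blockStart (ℕP.≤-trans (ℕP.m≤m+n N D) N+D≤k) ,
    blockStart-growth D k (ℕP.≤-trans (ℕP.m≤n+m D N) (ℕP.≤-trans N+D≤k k≤2[1+k]))
    where
    k≤2[1+k] : k ≤ 2 * suc k
    k≤2[1+k] = ℕP.≤-trans (ℕP.n≤1+n k) (ℕP.m≤n*m (suc k) 2)

  blockLength : ℕ → ℕ
  blockLength k = blockStart (suc k) ∸ blockStart k

  blockStart+blockLength : ∀ k → blockStart k + blockLength k ≡ blockStart (suc k)
  blockStart+blockLength k = ℕP.m+[n∸m]≡n (ℕP.<⇒≤ (blockStart-< k))

  blockStart+<next : ∀ {k j} → j < blockLength k → blockStart k + j < blockStart (suc k)
  blockStart+<next {k} {j} j<L =
    subst (blockStart k + j <_) (blockStart+blockLength k) (ℕP.+-monoʳ-< (blockStart k) j<L)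

  blockOf : ℕ → ℕ
  blockOf n = least (λ j → suc n ∸ blockStart (suc j)) (suc n)

  blockOf-unique : ∀ {n k} → blockStart k ≤ n → n < blockStart (suc k) → blockOf n ≡ k
  blockOf-unique {n} {k} lo hi =
    least-unique (s≤s (ℕP.≤-trans (n≤blockStart k) lo)) (ℕP.m≤n⇒m∸n≡0 hi)
      (λ j j<k ≡0 → ℕP.<-irrefl refl (ℕP.<-≤-trans (ℕP.m∸n≡0⇒m≤n ≡0) (ℕP.≤-trans (blockStart-mono j<k) lo)))

  blockOf-bounds : ∀ n → blockStart (blockOf n) ≤ n × n < blockStart (suc (blockOf n))
  blockOf-bounds n with least-spec (λ j → suc n ∸ blockStart (suc j)) (suc n)
  ... | none _ noZero = ⊥-elim (noZero n (ℕP.n<1+n n) (ℕP.m≤n⇒m∸n≡0 (<blockStart {n} ℕP.≤-refl)))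
  ... | found _ n<next below = lower (blockOf n) refl , ℕP.m∸n≡0⇒m≤n n<next
    where
    lower : ∀ k → k ≡ blockOf n → blockStart k ≤ n
    lower zero    _ = z≤n
    lower (suc k) 1+k≡ with blockStart (suc k) ℕP.≤? n
    ... | yes ≤n = ≤n
    ... | no  ≰n = ⊥-elim (below k (subst (k <_) 1+k≡ ℕP.≤-refl) (ℕP.m≤n⇒m∸n≡0 (ℕP.≰⇒> ≰n)))

  odd : ℕ → Bool
  odd zero    = false
  odd (suc n) = not (odd n)

  odd-2* : ∀ i → odd (2 * i) ≡ false
  odd-2* zero    = refl
  odd-2* (suc i) rewrite ℕP.+-suc i (i + 0) = trans (not-involutive _) (odd-2* i)

  blockStart-even : ∀ k → odd (blockStart k) ≡ false
  blockStart-even zero    = refl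
  blockStart-even (suc k) = odd-2* (suc k * suc (blockStart k))

  blockStartₚ : ∀ {O} → Program O 1
  blockStartₚ {O} = withSemantics (precₚ zeroₚ step) (λ { (k ∷ []) → blockStart k })
                                  (λ { (k ∷ []) → ⟦blockStartₚ⟧ k })
    where
    step : Program O 2
    step = constₚ 2 *ₚ (sucₚ (projₚ zero) *ₚ sucₚ (projₚ (suc zero)))
    ⟦blockStartₚ⟧ : ∀ k → rec (λ _ → 0) ⟦ step ⟧ k [] ≡ blockStart k
    ⟦blockStartₚ⟧ zero    = refl
    ⟦blockStartₚ⟧ (suc k) rewrite ⟦blockStartₚ⟧ k = refl

  blockLengthₚ : ∀ {O} → Program O 1
  blockLengthₚ = compₚ blockStartₚ (sucₚ (projₚ zero) ∷ []) ∸ₚ blockStartₚ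

  blockOfₚ : ∀ {O} → Program O 1
  blockOfₚ = compₚ (searchₚ (sucₚ (projₚ (suc zero)) ∸ₚ compₚ blockStartₚ (sucₚ (projₚ zero) ∷ [])))
                   (sucₚ (projₚ zero) ∷ projₚ zero ∷ [])

  oddₚ : ∀ {O} → Program O 1
  oddₚ {O} = withSemantics (precₚ zeroₚ step) (λ { (n ∷ []) → bit (odd n) }) (λ { (n ∷ []) → ⟦oddₚ⟧ n })
    where
    step : Program O 2
    step = 1ₚ ∸ₚ projₚ (suc zero)
    1∸bit : ∀ b → 1 ∸ bit b ≡ bit (not b)
    1∸bit false = refl
    1∸bit true  = refl
    ⟦oddₚ⟧ : ∀ n → rec (λ _ → 0) ⟦ step ⟧ n [] ≡ bit (odd n)
    ⟦oddₚ⟧ zero    = refl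
    ⟦oddₚ⟧ (suc n) rewrite ⟦oddₚ⟧ n = 1∸bit (odd n)

  module Construction (B : ℕ → Bool) where

    A : ℕ → Bool
    A n = B (blockOf n) xor odd n

    A-block : ∀ {k n} → blockStart k ≤ n → n < blockStart (suc k) → A n ≡ B k xor odd n
    A-block lo hi rewrite blockOf-unique lo hi = refl

    A-offset : ∀ {k j} → j < blockLength k → A (blockStart k + j) ≡ B k xor odd (blockStart k + j)
    A-offset {k} j<L = A-block {k} (ℕP.m≤m+n _ _) (blockStart+<next {k} j<L)

    A-blockStart : ∀ k → A (blockStart k) ≡ B k
    A-blockStart k = begin
      A (blockStart k)             ≡⟨ A-block ℕP.≤-refl (blockStart-< k) ⟩
      B k xor odd (blockStart k)   ≡⟨ cong (B k xor_) (blockStart-even k) ⟩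
      B k xor false                ≡⟨ xor-identityʳ (B k) ⟩
      B k                          ∎
      where open ≡-Reasoning

    A≤TB : A ≤T B
    A≤TB = code decide , λ n →
      subst (Eval B (code decide) (n ∷ [])) (1∸δ-bit (B (blockOf n)) (odd n)) (eval decide (n ∷ []))
      where
      decide : Program B 1
      decide = 1ₚ ∸ₚ (oracleₚ blockOfₚ ==ₚ oddₚ)

    B≤TA : B ≤T A
    B≤TA = code decide , λ k →
      subst (Eval A (code decide) (k ∷ [])) (cong bit (A-blockStart k)) (eval decide (k ∷ []))
      where
      decide : Program A 1
      decide = oracleₚ blockStartₚ

module Alpha where

  open Arithmetic
  open Programs
  open StepBounded
  open Blocks
  open Density
  open Counting

  module Decoder (c : Code 1) where

    firstHalt : ℕ → ℕ → ℕ
    firstHalt s k = least (λ j → δ (run ∅ c s (blockStart k + j ∷ [])) 0) (blockLength k)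

    probe : ℕ → ℕ → ℕ
    probe s k = blockStart k + firstHalt s k

    -- 0 exactly when, by stage s, the program has halted at some point of block k.
    searching : ℕ → ℕ → ℕ
    searching s k = 1 ∸ (blockLength k ∸ firstHalt s k)

    guess : ℕ → ℕ → ℕ
    guess s k = 1 ∸ δ (ℕ.pred (run ∅ c s (probe s k ∷ []))) (bit (odd (probe s k)))

    private
      sₚ kₚ : Program ∅ 2
      sₚ = projₚ zero
      kₚ = projₚ (suc zero)

      firstHaltₚ : Program ∅ 2
      firstHaltₚ = compₚ (searchₚ (compₚ (runₚ ∅ c) (projₚ (suc zero) ∷ startₚ +ₚ projₚ zero ∷ []) ==ₚ zeroₚ))
                         (compₚ blockLengthₚ (kₚ ∷ []) ∷ sₚ ∷ kₚ ∷ [])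
        where
        startₚ = compₚ blockStartₚ (projₚ (suc (suc zero)) ∷ [])

      searchingₚ guessₚ : Program ∅ 2
      searchingₚ = withSemantics (1ₚ ∸ₚ (compₚ blockLengthₚ (kₚ ∷ []) ∸ₚ firstHaltₚ))
                                 (λ { (s ∷ k ∷ []) → searching s k }) (λ { (s ∷ k ∷ []) → refl })
      guessₚ = withSemantics (1ₚ ∸ₚ (predₚ (compₚ (runₚ ∅ c) (sₚ ∷ probeₚ ∷ [])) ==ₚ compₚ oddₚ (probeₚ ∷ [])))
                             (λ { (s ∷ k ∷ []) → guess s k }) (λ { (s ∷ k ∷ []) → refl })
        where
        probeₚ = compₚ blockStartₚ (kₚ ∷ []) +ₚ firstHaltₚ

    decoder : Code 1
    decoder = comp (code guessₚ) (mu (code searchingₚ) ∷ proj zero ∷ [])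

    searching≡0⇒firstHalt< : ∀ {s k} → searching s k ≡ 0 → firstHalt s k < blockLength k
    searching≡0⇒firstHalt< {s} {k} ≡0 =
      ℕP.m∸n≢0⇒n<m (λ L∸F≡0 → ℕP.1+n≢0 (trans (cong (1 ∸_) (sym L∸F≡0)) ≡0))

    halted-in-block⇒searching≡0 : ∀ {k x s v} → blockStart k ≤ x → x < blockStart (suc k) →
                                  run ∅ c s (x ∷ []) ≡ suc v → searching s k ≡ 0
    halted-in-block⇒searching≡0 {k} {x} {s} lo hi halts = ℕP.m≤n⇒m∸n≡0 (ℕP.m<n⇒0<n∸m firstHalt<L)
      where
      j = x ∸ blockStart k
      start+j≡x : blockStart k + j ≡ x
      start+j≡x = ℕP.m+[n∸m]≡n lo
      j<L : j < blockLength k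
      j<L = ℕP.+-cancelˡ-< (blockStart k) j (blockLength k)
              (subst₂ _<_ (sym start+j≡x) (sym (blockStart+blockLength k)) hi)
      firstHalt<L : firstHalt s k < blockLength k
      firstHalt<L = least-< j<L (cong (λ r → δ r 0) (trans (cong (λ y → run ∅ c s (y ∷ [])) start+j≡x) halts))

    searching≡0⇒halted : ∀ {s k} → searching s k ≡ 0 → Σ ℕ λ v → run ∅ c s (probe s k ∷ []) ≡ suc v
    searching≡0⇒halted {s} {k} ≡0
      with run ∅ c s (probe s k ∷ []) | least-found _ (blockLength k) (searching≡0⇒firstHalt< {s} {k} ≡0)
    ... | suc v | _ = v , refl

    HaltsInBlock : ℕ → Set
    HaltsInBlock k = Σ ℕ λ x → blockStart k ≤ x × x < blockStart (suc k) × Σ ℕ λ v → Eval ∅ c (x ∷ []) v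

    module _ (B : ℕ → Bool) (correct : ∀ n v → Eval ∅ c (n ∷ []) v → v ≡ bit (Construction.A B n)) where
      open Construction B

      guess-correct : ∀ {s k} → searching s k ≡ 0 → guess s k ≡ bit (B k)
      guess-correct {s} {k} ≡0 with searching≡0⇒halted {s} {k} ≡0
      ... | v , halts = begin
        1 ∸ δ (ℕ.pred (run ∅ c s (n ∷ []))) (bit (odd n))  ≡⟨ cong (λ r → 1 ∸ δ (ℕ.pred r) (bit (odd n))) halts ⟩
        1 ∸ δ v (bit (odd n))                              ≡⟨ cong (λ w → 1 ∸ δ w (bit (odd n))) v≡An ⟩
        1 ∸ δ (bit (A n)) (bit (odd n))                    ≡⟨ 1∸δ-bit (A n) (odd n) ⟩
        bit (A n xor odd n)                                ≡⟨ cong (λ b → bit (b xor odd n)) An≡ ⟩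
        bit ((B k xor odd n) xor odd n)                    ≡⟨ cong bit (xor-assoc (B k) (odd n) (odd n)) ⟩
        bit (B k xor (odd n xor odd n))                    ≡⟨ cong (λ b → bit (B k xor b)) (xor-same (odd n)) ⟩
        bit (B k xor false)                                ≡⟨ cong bit (xor-identityʳ (B k)) ⟩
        bit (B k)                                          ∎
        where
        open ≡-Reasoning
        n = probe s k
        v≡An : v ≡ bit (A n)
        v≡An = correct n v (run-sound ∅ c s _ halts)
        An≡ : A n ≡ B k xor odd n
        An≡ = A-offset (searching≡0⇒firstHalt< {s} {k} ≡0)

      decoder-correct : ∀ k → HaltsInBlock k → Eval ∅ decoder (k ∷ []) (bit (B k))
      decoder-correct k (x , lo , hi , v , evx) with run-complete ∅ evx
      ... | s₀ , halts with μ-halts searchingₚ (k ∷ []) (halted-in-block⇒searching≡0 {k} {x} {s₀} lo hi halts)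
      ...   | s , ≡0 , evalμ = subst (Eval ∅ decoder (k ∷ [])) (guess-correct {s} {k} ≡0)
                                     (e-comp (ea-∷ evalμ (ea-∷ (e-proj zero) ea-[])) (eval guessₚ (s ∷ k ∷ [])))

  alpha : ∀ (B : ℕ → Bool) → ¬ Computable B → AlphaIsZero (Construction.A B)
  alpha B B-incomputable r 0<r (c , correct , dense) with ℚP.<-dense 0<r
  ... | m , 0<m , m<r with 0<q⇒∃[D]N≤D*L m 0<m | lowerDensity⇒eventually-ρ≥ dense m<r
  ...   | D , linear | N₀ , ρ≥ =
    B-incomputable (eventuallyCorrect⇒Computable B (N₀ + D) (decoder c)
                     (λ k N₀+D≤k → decoder-correct c B correct k (halts-in-block k N₀+D≤k)))
    where
    open Decoder
    halts-in-block : ∀ k → N₀ + D ≤ k → HaltsInBlock c k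
    halts-in-block k N₀+D≤k =
      let N₀<N , growth = late-block N₀+D≤k
          xs , unique , below , m*N≤len = ρ≥ (blockStart (suc k)) N₀<N
      in length>⇒∃≥ (blockStart k) unique below (ℕP.*-cancelˡ-< D _ _ (ℕP.<-≤-trans growth (linear _ _ m*N≤len)))

module Gamma where

  open Density
  open Counting
  open Arithmetic
  open Programs
  open Blocks

  even-or-odd : ∀ n → Σ ℕ λ i → n ≡ 2 * i ⊎ n ≡ suc (2 * i)
  even-or-odd zero = 0 , inj₁ refl
  even-or-odd (suc n) with even-or-odd n
  ... | i , inj₁ n≡2i  = i , inj₂ (cong suc n≡2i)
  ... | i , inj₂ n≡1+2i = suc i , inj₁ (trans (cong suc n≡1+2i) (sym (ℕP.*-suc 2 i)))

  module _ (B : ℕ → Bool) where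
    open Construction B

    A-pair : ∀ i → A (suc (2 * i)) ≡ not (A (2 * i))
    A-pair i with blockOf-bounds (2 * i)
    ... | lo , hi = trans (A-block (ℕP.m≤n⇒m≤1+n lo) 1+2i<next) (sym (not-distribʳ-xor (B K) (odd (2 * i))))
      where
      K = blockOf (2 * i)
      1+2i<next : suc (2 * i) < blockStart (suc K)
      1+2i<next = ℕP.≤-trans (ℕP.≤-reflexive (sym (ℕP.*-suc 2 i)))
                    (ℕP.*-monoʳ-≤ 2 (ℕP.*-cancelˡ-< 2 i (suc K * suc (blockStart K)) hi))

    count-zeros-2* : ∀ i → count (not ∘ A) (2 * i) ≡ i
    count-zeros-2* zero    = refl
    count-zeros-2* (suc i) = begin
      count (not ∘ A) (2 * suc i)
        ≡⟨ cong (count (not ∘ A)) (ℕP.*-suc 2 i) ⟩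
      count (not ∘ A) (2 * i) + bit (not (A (2 * i))) + bit (not (A (suc (2 * i))))
        ≡⟨ cong₂ (λ c b → c + bit (not (A (2 * i))) + bit (not b)) (count-zeros-2* i) (A-pair i) ⟩
      i + bit (not (A (2 * i))) + bit (not (not (A (2 * i))))
        ≡⟨ one-of-each i (A (2 * i)) ⟩
      suc i
        ∎
      where
      open ≡-Reasoning
      one-of-each : ∀ i b → i + bit (not b) + bit (not (not b)) ≡ suc i
      one-of-each i false = trans (ℕP.+-identityʳ (i + 1)) (ℕP.+-comm i 1)
      one-of-each i true  = trans (cong (_+ 1) (ℕP.+-identityʳ i)) (ℕP.+-comm i 1)

    n≤1+2*count-zeros : ∀ n → n ≤ suc (2 * count (not ∘ A) n)
    n≤1+2*count-zeros n with even-or-odd n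
    ... | i , inj₁ refl rewrite count-zeros-2* i = ℕP.n≤1+n _
    ... | i , inj₂ refl rewrite count-zeros-2* i = s≤s (ℕP.*-monoʳ-≤ 2 (ℕP.m≤m+n i _))

    gamma-lower : ∀ r → r ℚ.< ½ → CoarselyComputableAt A r
    gamma-lower r r<½ = (λ _ → false) , (zro , λ _ → e-zro) , dense
      where
      dense : LowerDensityAtLeast (λ n → A n ≡ false) r
      dense ε 0<ε with q<½⇒∃[D]q*M≤c (r ℚ.- ε) (ℚP.<-trans (r-ε<r r ε 0<ε) r<½)
      ... | D , bound = D , λ n D≤n →
        let unique , zeros , length≡ = listing-spec (not ∘ A) (suc n) in
        listing (not ∘ A) (suc n) , unique ,
        All.map (λ { {x} (x<1+n , notA) → x<1+n , not≡true (A x) notA }) zeros ,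
        subst (λ len → (r ℚ.- ε) ℚ.* ℕtoℚ (suc n) ℚ.≤ ℕtoℚ len) (sym length≡)
              (bound (suc n) (count (not ∘ A) (suc n)) (ℕP.m≤n⇒m≤1+n D≤n) (n≤1+2*count-zeros (suc n)))
        where
        not≡true : ∀ b → not b ≡ true → b ≡ false
        not≡true false _ = refl

  tail-majority : ∀ D M L X len → suc D * (M + L) ≤ 2 * (D * len) → len ≤ M + X → D * M < M + L → L < 2 * X
  tail-majority D M L X len bound len≤M+X DM<M+L with L ℕP.<? 2 * X
  ... | yes L<2X = L<2X
  ... | no  L≮2X = ⊥-elim (ℕP.<⇒≱ DM<M+L (ℕP.+-cancelʳ-≤ (D * M + D * L) (M + L) (D * M) (begin
    M + L + (D * M + D * L)        ≡⟨ expandˡ D M L ⟩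
    suc D * (M + L)                ≤⟨ bound ⟩
    2 * (D * len)                  ≤⟨ ℕP.*-monoʳ-≤ 2 (ℕP.*-monoʳ-≤ D len≤M+X) ⟩
    2 * (D * (M + X))              ≡⟨ expandʳ D M X ⟩
    D * M + D * M + D * (2 * X)    ≤⟨ ℕP.+-monoʳ-≤ (D * M + D * M) (ℕP.*-monoʳ-≤ D (ℕP.≮⇒≥ L≮2X)) ⟩
    D * M + D * M + D * L          ≡⟨ ℕP.+-assoc (D * M) (D * M) (D * L) ⟩
    D * M + (D * M + D * L)        ∎)))
    where
    open ℕP.≤-Reasoning
    expandˡ : ∀ D M L → M + L + (D * M + D * L) ≡ suc D * (M + L)
    expandˡ = solve-∀
    expandʳ : ∀ D M X → 2 * (D * (M + X)) ≡ D * M + D * M + D * (2 * X)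
    expandʳ = solve-∀

  minority : ∀ S X L → S + X ≡ L → L < 2 * X → 2 * S < L
  minority S X L S+X≡L L<2X = ℕP.+-cancelʳ-< L (2 * S) L (begin-strict
    2 * S + L        <⟨ ℕP.+-monoʳ-< (2 * S) L<2X ⟩
    2 * S + 2 * X    ≡⟨ ℕP.*-distribˡ-+ 2 S X ⟨
    2 * (S + X)      ≡⟨ cong (2 *_) S+X≡L ⟩
    2 * L            ≡⟨ cong (L +_) (ℕP.+-identityʳ L) ⟩
    L + L            ∎)
    where open ℕP.≤-Reasoning

  module Majority (C : ℕ → Bool) (C-computable : Computable C) where

    -- Each n in block k votes for B k = C n xor odd n, which is right whenever C n agrees with A n.
    votes : ℕ → ℕ
    votes k = sumBelow (λ j → bit (C (blockStart k + j) xor odd (blockStart k + j))) (blockLength k)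

    verdict : ℕ → ℕ
    verdict k = sg (2 * votes k ∸ blockLength k)

    verdictₚ : Program ∅ 1
    verdictₚ = withSemantics (sgₚ (constₚ 2 *ₚ compₚ (sumₚ vote) (blockLengthₚ ∷ projₚ zero ∷ []) ∸ₚ blockLengthₚ))
                             (λ { (k ∷ []) → verdict k }) (λ { (k ∷ []) → refl })
      where
      vote = withSemantics (1ₚ ∸ₚ (compₚ (≤T⇒Program C-computable) (positionₚ ∷ []) ==ₚ compₚ oddₚ (positionₚ ∷ [])))
                           (λ { (j ∷ k ∷ []) → bit (C (blockStart k + j) xor odd (blockStart k + j)) })
                           (λ { (j ∷ k ∷ []) → 1∸δ-bit (C (blockStart k + j)) (odd (blockStart k + j)) })
        where
        positionₚ = compₚ blockStartₚ (projₚ (suc zero) ∷ []) +ₚ projₚ zero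

    module _ (B : ℕ → Bool) where
      open Construction B

      agrees : ℕ → Bool
      agrees n = not (A n xor C n)

      agreements : ℕ → ℕ
      agreements k = sumBelow (λ j → bit (agrees (blockStart k + j))) (blockLength k)

      private
        vote-true : ∀ o c → c xor o ≡ not ((true xor o) xor c)
        vote-true false false = refl
        vote-true false true  = refl
        vote-true true  false = refl
        vote-true true  true  = refl

        vote-false : ∀ o c → bit (c xor o) + bit (not ((false xor o) xor c)) ≡ 1
        vote-false false false = refl
        vote-false false true  = refl
        vote-false true  false = refl
        vote-false true  true  = refl

        sg-pos : ∀ {x} → 0 < x → sg x ≡ 1
        sg-pos {suc _} _ = refl

      votes≡agreements : ∀ k → B k ≡ true → votes k ≡ agreements k
      votes≡agreements k Bk≡true = sumBelow-cong (blockLength k) λ j j<L →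
        cong bit (trans (vote-true (odd (n j)) (C (n j)))
                        (cong (λ a → not (a xor C (n j))) (sym (A≡ j j<L))))
        where
        n : ℕ → ℕ
        n j = blockStart k + j
        A≡ : ∀ j → j < blockLength k → A (n j) ≡ true xor odd (n j)
        A≡ j j<L = trans (A-offset {k} j<L) (cong (_xor odd (n j)) Bk≡true)

      votes+agreements : ∀ k → B k ≡ false → votes k + agreements k ≡ blockLength k
      votes+agreements k Bk≡false = begin
        votes k + agreements k                                    ≡⟨ sumBelow-+ _ _ (blockLength k) ⟨
        sumBelow (λ j → bit (C (n j) xor odd (n j)) + bit (agrees (n j))) (blockLength k)
                                      ≡⟨ sumBelow-cong (blockLength k) (λ j j<L → trans
                                           (cong (λ a → bit (C (n j) xor odd (n j)) + bit (not (a xor C (n j))))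
                                                 (trans (A-offset j<L) (cong (_xor odd (n j)) Bk≡false)))
                                           (vote-false (odd (n j)) (C (n j)))) ⟩
        sumBelow (λ _ → 1) (blockLength k)                         ≡⟨ sumBelow-1 (blockLength k) ⟩
        blockLength k                                             ∎
        where
        open ≡-Reasoning
        n : ℕ → ℕ
        n j = blockStart k + j

      verdict-correct : ∀ k → blockLength k < 2 * agreements k → verdict k ≡ bit (B k)
      verdict-correct k L<2X with B k in Bk
      ... | true  rewrite votes≡agreements k Bk = sg-pos (ℕP.m<n⇒0<n∸m L<2X)
      ... | false = cong sg (ℕP.m≤n⇒m∸n≡0 (ℕP.<⇒≤ 2S<L))
        where
        2S<L : 2 * votes k < blockLength k
        2S<L = minority (votes k) (agreements k) (blockLength k) (votes+agreements k Bk) L<2X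

      length≤start+agreements : ∀ k {xs} → Unique xs → All (λ x → x < blockStart (suc k) × A x ≡ C x) xs →
                                length xs ≤ blockStart k + agreements k
      length≤start+agreements k {xs} unique below = begin
        length xs
          ≤⟨ length≤count agrees _ unique (All.map agree below) ⟩
        count agrees (blockStart (suc k))
          ≡⟨ cong (count agrees) (blockStart+blockLength k) ⟨
        count agrees (blockStart k + blockLength k)
          ≡⟨ sumBelow-++ (bit ∘ agrees) (blockStart k) (blockLength k) ⟩
        count agrees (blockStart k) + agreements k
          ≤⟨ ℕP.+-monoˡ-≤ (agreements k) (count≤ agrees (blockStart k)) ⟩
        blockStart k + agreements k
          ∎
        where
        open ℕP.≤-Reasoning
        agree : ∀ {x} → x < blockStart (suc k) × A x ≡ C x → x < blockStart (suc k) × agrees x ≡ true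
        agree {x} (x<N , Ax≡Cx) = x<N , cong not (trans (cong (_xor C x) Ax≡Cx) (xor-same (C x)))

  gamma-upper : ∀ B → ¬ Computable B → ∀ r → ½ ℚ.< r → ¬ CoarselyComputableAt (Construction.A B) r
  gamma-upper B B-incomputable r ½<r (C , C-computable , dense) with ℚP.<-dense ½<r
  ... | m , ½<m , m<r with ½<q⇒∃[D][1+D]N≤2DL m ½<m | lowerDensity⇒eventually-ρ≥ dense m<r
  ...   | D , bound | N₀ , ρ≥ =
    B-incomputable (eventuallyCorrect⇒Computable B (N₀ + D) (code verdictₚ) λ k N₀+D≤k →
      subst (Eval ∅ (code verdictₚ) (k ∷ [])) (verdict-correct B k (majority k N₀+D≤k)) (eval verdictₚ (k ∷ [])))
    where
    open Majority C C-computable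
    majority : ∀ k → N₀ + D ≤ k → blockLength k < 2 * agreements B k
    majority k N₀+D≤k =
      let N₀<N , growth = late-block N₀+D≤k
          xs , unique , below , m*N≤len = ρ≥ (blockStart (suc k)) N₀<N
          N≡ = sym (blockStart+blockLength k)
      in tail-majority D (blockStart k) (blockLength k) (agreements B k) (length xs)
           (subst (λ N → suc D * N ≤ 2 * (D * length xs)) N≡ (bound _ (length xs) m*N≤len))
           (length≤start+agreements B k unique below)
           (subst (D * blockStart k <_) N≡ growth)

open Blocks using (module Construction)
open Alpha using (alpha)
open Gamma using (gamma-lower; gamma-upper)

theorem2p1 : (B : ℕ → Bool) → ¬ Computable B →
    Σ (ℕ → Bool) λ A → (A ≡T B) × AlphaIsZero A × GammaIs A ½
theorem2p1 B B-incomputable =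
  A , (A≤TB , B≤TA) , alpha B B-incomputable , gamma-lower B , gamma-upper B B-incomputable
  where open Construction B
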